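{- Let $G$ be a finite simple connected graph with at least three vertices. Then $\chi'_L(G)=2$ if and only if $G$ is isomorphic to the path $P_3$ on three vertices.
   Context: For a proper edge coloring $c:E(G)\to\{1,\dots,k\}$ of a graph $G$, let $\pi=(\mathcal{C}_1,\dots,\mathcal{C}_k)$ be the ordered partition of $E(G)$ into color classes. For a vertex $v$ and an edge $e=xy$, $d(v,e)=\min\{d(v,x),d(v,y)\}$, and $d(v,\mathcal{C}_i)=\min\{d(v,e): e\in\mathcal{C}_i\}$. The edge color code of $v$ is $c_\pi(v)=(d(v,\mathcal{C}_1),\dots,d(v,\mathcal{C}_k))$. The coloring $c$ is an edge-locating coloring if distinct vertices have distinct edge color codes; $\chi'_L(G)$ is the minimum $k$ for which $G$ has an edge-locating coloring with $k$ colors. -}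

module Defs where

open import Data.Nat using (ℕ; zero; suc; _≤_; _<_; _⊔_; _⊓_)
open import Data.Fin using (Fin)
open import Data.Bool using (Bool; true; false)
open import Data.Product using (Σ; ∃; ∃-syntax; _×_; _,_)
open import Relation.Binary.PropositionalEquality using (_≡_; _≢_)
open import Relation.Nullary using (¬_)
open import Function.Bundles using (_↔_; Inverse)

record Graph (n : ℕ) : Set where
  field
    adj   : Fin n → Fin n → Bool
    sym   : ∀ u v → adj u v ≡ adj v u
    irrefl : ∀ v → adj v v ≡ false

open Graph public

Adj : ∀ {n} → Graph n → Fin n → Fin n → Set
Adj G u v = adj G u v ≡ true

data Walk {n} (G : Graph n) : Fin n → Fin n → ℕ → Set where
  here : ∀ {v} → Walk G v v zero
  step : ∀ {u w v m} → Adj G u w → Walk G w v m → Walk G u v (suc m)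

Connected : ∀ {n} → Graph n → Set
Connected G = ∀ u v → ∃[ m ] Walk G u v m

Dist : ∀ {n} → Graph n → Fin n → Fin n → ℕ → Set
Dist G u v m = Walk G u v m × (∀ k → Walk G u v k → m ≤ k)

-- An edge colouring with k colours: a colour assigned to every ordered pair,
-- of which only the values on edges matter.
Colouring : ℕ → ℕ → Set
Colouring n k = Fin n → Fin n → Fin k

-- Proper edge colouring: well defined on the (undirected) edges, adjacent
-- edges get distinct colours, and every colour class is nonempty
-- (π = (C₁,…,C_k) is an ordered partition of E(G) into colour classes).
IsProperEdgeColouring : ∀ {n k} → Graph n → Colouring n k → Set
IsProperEdgeColouring {n} {k} G c =
    (∀ u v → Adj G u v → c u v ≡ c v u)
  × (∀ u v w → Adj G u v → Adj G u w → v ≢ w → c u v ≢ c u w)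
  × (∀ (i : Fin k) → ∃[ x ] ∃[ y ] (Adj G x y × c x y ≡ i))

DistToEdge : ∀ {n} → Graph n → Fin n → Fin n → Fin n → ℕ → Set
DistToEdge G v x y m = ∃[ a ] ∃[ b ] (Dist G v x a × Dist G v y b × m ≡ a ⊓ b)

DistToClass : ∀ {n k} → Graph n → Colouring n k → Fin n → Fin k → ℕ → Set
DistToClass G c v i m =
    (∃[ x ] ∃[ y ] (Adj G x y × c x y ≡ i × DistToEdge G v x y m))
  × (∀ x y → Adj G x y → c x y ≡ i → ∀ m' → DistToEdge G v x y m' → m ≤ m')

SameCode : ∀ {n k} → Graph n → Colouring n k → Fin n → Fin n → Set
SameCode G c u v = ∀ i m → (DistToClass G c u i m → DistToClass G c v i m)
                         × (DistToClass G c v i m → DistToClass G c u i m)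

IsEdgeLocatingColouring : ∀ {n k} → Graph n → Colouring n k → Set
IsEdgeLocatingColouring G c =
  IsProperEdgeColouring G c × (∀ u v → SameCode G c u v → u ≡ v)

HasEdgeLocatingColouring : ∀ {n} → Graph n → ℕ → Set
HasEdgeLocatingColouring {n} G k = Σ (Colouring n k) (IsEdgeLocatingColouring G)

EdgeLocatingChromaticIndex : ∀ {n} → Graph n → ℕ → Set
EdgeLocatingChromaticIndex G k =
  HasEdgeLocatingColouring G k × (∀ j → j < k → ¬ HasEdgeLocatingColouring G j)

P3adj : Fin 3 → Fin 3 → Bool
P3adj Fin.zero (Fin.suc Fin.zero) = true
P3adj (Fin.suc Fin.zero) Fin.zero = true
P3adj (Fin.suc Fin.zero) (Fin.suc (Fin.suc Fin.zero)) = true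
P3adj (Fin.suc (Fin.suc Fin.zero)) (Fin.suc Fin.zero) = true
P3adj _ _ = false

P3 : Graph 3
P3 = record { adj = P3adj ; sym = s ; irrefl = i }
  where
  s : ∀ u v → P3adj u v ≡ P3adj v u
  s Fin.zero Fin.zero = _≡_.refl
  s Fin.zero (Fin.suc Fin.zero) = _≡_.refl
  s Fin.zero (Fin.suc (Fin.suc Fin.zero)) = _≡_.refl
  s (Fin.suc Fin.zero) Fin.zero = _≡_.refl
  s (Fin.suc Fin.zero) (Fin.suc Fin.zero) = _≡_.refl
  s (Fin.suc Fin.zero) (Fin.suc (Fin.suc Fin.zero)) = _≡_.refl
  s (Fin.suc (Fin.suc Fin.zero)) Fin.zero = _≡_.refl
  s (Fin.suc (Fin.suc Fin.zero)) (Fin.suc Fin.zero) = _≡_.refl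
  s (Fin.suc (Fin.suc Fin.zero)) (Fin.suc (Fin.suc Fin.zero)) = _≡_.refl
  i : ∀ v → P3adj v v ≡ false
  i Fin.zero = _≡_.refl
  i (Fin.suc Fin.zero) = _≡_.refl
  i (Fin.suc (Fin.suc Fin.zero)) = _≡_.refl

Isomorphic : ∀ {n m} → Graph n → Graph m → Set
Isomorphic {n} {m} G H =
  Σ (Fin n ↔ Fin m) λ f → ∀ u v → adj G u v ≡ adj H (Inverse.to f u) (Inverse.to f v)

-- A vertex is at distance 0 from a colour class exactly when it is
-- incident to an edge of that colour, so two vertices incident to all colours
-- have the same code. With one colour every vertex of a connected graph on at
-- least two vertices is such a vertex. With two colours a proper colouring
-- allows degree at most 2, and every vertex of degree 2 is incident to both
-- colours, so there is at most one of them; a connected graph on at least three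
-- vertices has one, its neighbours are then leaves, and the graph is P₃.
-- Conversely, colouring the two edges of P₃ differently separates its three
-- vertices already by the sets of colours they are incident to.
module Submission where

open import Defs
open import Data.Nat using (ℕ; _≤_; _<_; zero; suc; z≤n; s≤s)
open import Data.Nat.Properties using (n≤0⇒n≡0)
open import Data.Product using (_×_; ∃; ∃-syntax; _,_; proj₁; proj₂; swap)
open import Data.Sum using (_⊎_; inj₁; inj₂; map₂)
open import Data.Empty using (⊥; ⊥-elim)
open import Data.Bool using (true; false)
import Data.Bool.Properties as Bool
open import Data.Fin using (Fin; zero; suc)
open import Data.Fin.Properties using (any?) renaming (_≟_ to _≟ᶠ_)
open import Function using (_∘_)
open import Function.Bundles using (_↔_; Inverse; Injection; mk↔ₛ′)
open import Function.Properties.Inverse using (↔⇒↣)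
open import Relation.Nullary using (¬_; Dec; yes; no)
open import Relation.Nullary.Decidable using (_×-dec_; ¬?; decidable-stable)
open import Relation.Binary.PropositionalEquality
  using (_≡_; _≢_; refl; cong; cong₂; subst)
import Relation.Binary.PropositionalEquality as ≡

Fin1-irrelevant : (a b : Fin 1) → a ≡ b
Fin1-irrelevant zero zero = refl

Fin2-either : (a b i : Fin 2) → a ≢ b → i ≡ a ⊎ i ≡ b
Fin2-either zero       zero       _          a≢b = ⊥-elim (a≢b refl)
Fin2-either zero       (suc zero) zero       _   = inj₁ refl
Fin2-either zero       (suc zero) (suc zero) _   = inj₂ refl
Fin2-either (suc zero) zero       zero       _   = inj₂ refl
Fin2-either (suc zero) zero       (suc zero) _   = inj₁ refl
Fin2-either (suc zero) (suc zero) _          a≢b = ⊥-elim (a≢b refl)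

three-distinct-∉-pair : ∀ {A : Set} {x y a b d : A} →
  a ≡ x ⊎ a ≡ y → b ≡ x ⊎ b ≡ y → d ≡ x ⊎ d ≡ y → a ≢ b → a ≢ d → b ≢ d → ⊥
three-distinct-∉-pair (inj₁ refl) (inj₁ refl) _           a≢b _   _   = a≢b refl
three-distinct-∉-pair (inj₂ refl) (inj₂ refl) _           a≢b _   _   = a≢b refl
three-distinct-∉-pair (inj₁ refl) (inj₂ refl) (inj₁ refl) _   a≢d _   = a≢d refl
three-distinct-∉-pair (inj₁ refl) (inj₂ refl) (inj₂ refl) _   _   b≢d = b≢d refl
three-distinct-∉-pair (inj₂ refl) (inj₁ refl) (inj₁ refl) _   _   b≢d = b≢d refl
three-distinct-∉-pair (inj₂ refl) (inj₁ refl) (inj₂ refl) _   a≢d _   = a≢d refl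

module _ {n : ℕ} (G : Graph n) where

  Adj-sym : ∀ {u v} → Adj G u v → Adj G v u
  Adj-sym {u} {v} u~v = ≡.trans (Graph.sym G v u) u~v

  ¬Adj-refl : ∀ v → ¬ Adj G v v
  ¬Adj-refl v v~v with ≡.trans (≡.sym (irrefl G v)) v~v
  ... | ()

  Adj⇒≢ : ∀ {u v} → Adj G u v → u ≢ v
  Adj⇒≢ {u} u~u refl = ¬Adj-refl u u~u

  ¬Adj⇒adj≡false : ∀ {u v} → ¬ Adj G u v → adj G u v ≡ false
  ¬Adj⇒adj≡false = Bool.¬-not

  Dist-refl : ∀ u → Dist G u u 0
  Dist-refl u = here , λ _ _ → z≤n

  Adj⇒Dist1 : ∀ {u v} → Adj G u v → Dist G u v 1
  Adj⇒Dist1 {u} {v} u~v = step u~v here , shortest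
    where
    shortest : ∀ k → Walk G u v k → 1 ≤ k
    shortest zero    here = ⊥-elim (¬Adj-refl u u~v)
    shortest (suc k) _    = s≤s z≤n

  Closed : (Fin n → Set) → Set
  Closed S = ∀ {u v} → S u → Adj G u v → S v

  Walk-closed : ∀ {S} → Closed S → ∀ {u v m} → S u → Walk G u v m → S v
  Walk-closed closed s here          = s
  Walk-closed closed s (step u~w ws) = Walk-closed closed (closed s u~w) ws

  connected-closed⇒total : Connected G → ∀ {S} → Closed S → ∀ {u} → S u → ∀ v → S v
  connected-closed⇒total conn closed {u} s v = Walk-closed closed s (proj₂ (conn u v))

  connected⇒neighbour : Connected G → ∀ {u v} → u ≢ v → ∃[ w ] Adj G u w
  connected⇒neighbour conn {u} {v} u≢v with conn u v
  ... | _ , here            = ⊥-elim (u≢v refl)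
  ... | _ , step {w = w} u~w _ = w , u~w

  OtherNeighbour : Fin n → Fin n → Set
  OtherNeighbour u w = ∃[ v ] (Adj G u v × v ≢ w)

  otherNeighbour? : ∀ u w → Dec (OtherNeighbour u w)
  otherNeighbour? u w = any? λ v → (adj G u v Bool.≟ true) ×-dec ¬? (v ≟ᶠ w)

  ¬OtherNeighbour⇒≡ : ∀ {u v w} → ¬ OtherNeighbour u w → Adj G u v → v ≡ w
  ¬OtherNeighbour⇒≡ {v = v} {w} ¬other u~v =
    decidable-stable (v ≟ᶠ w) (λ v≢w → ¬other (v , u~v , v≢w))

  HasTwoNeighbours : Fin n → Set
  HasTwoNeighbours u = ∃[ p ] ∃[ q ] (Adj G u p × Adj G u q × p ≢ q)

  -- Otherwise an edge x — w, with neither end having another neighbour, would be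
  -- a closed set of at most two vertices containing x, y and z.
  connected⇒∃HasTwoNeighbours : Connected G → (x y z : Fin n) →
    x ≢ y → x ≢ z → y ≢ z → ∃ HasTwoNeighbours
  connected⇒∃HasTwoNeighbours conn x y z x≢y x≢z y≢z
    with connected⇒neighbour conn x≢y
  ... | w , x~w with otherNeighbour? x w
  ...   | yes (v , x~v , v≢w) = x , v , w , x~v , x~w , v≢w
  ...   | no ¬otherˣ with otherNeighbour? w x
  ...     | yes (v , w~v , v≢x) = w , v , x , w~v , Adj-sym x~w , v≢x
  ...     | no ¬otherʷ =
    ⊥-elim (three-distinct-∉-pair (inEdge x) (inEdge y) (inEdge z) x≢y x≢z y≢z)
    where
    closed : Closed (λ v → v ≡ x ⊎ v ≡ w)
    closed (inj₁ refl) x~v = inj₂ (¬OtherNeighbour⇒≡ ¬otherˣ x~v)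
    closed (inj₂ refl) w~v = inj₁ (¬OtherNeighbour⇒≡ ¬otherʷ w~v)
    inEdge : ∀ v → v ≡ x ⊎ v ≡ w
    inEdge = connected-closed⇒total conn closed (inj₁ refl)

  module _ {p m q : Fin n} (m~p : Adj G m p) (m~q : Adj G m q) (p≁q : ¬ Adj G p q)
           (p≢q : p ≢ q) (cover : ∀ v → v ≡ p ⊎ v ≡ m ⊎ v ≡ q) where

    private
      from : Fin 3 → Fin n
      from zero             = p
      from (suc zero)       = m
      from (suc (suc zero)) = q

      to : Fin n → Fin 3
      to v with cover v
      ... | inj₁ _        = zero
      ... | inj₂ (inj₁ _) = suc zero
      ... | inj₂ (inj₂ _) = suc (suc zero)

      from-to : ∀ v → from (to v) ≡ v
      from-to v with cover v
      ... | inj₁ v≡p        = ≡.sym v≡p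
      ... | inj₂ (inj₁ v≡m) = ≡.sym v≡m
      ... | inj₂ (inj₂ v≡q) = ≡.sym v≡q

      from-injective : ∀ i j → from i ≡ from j → i ≡ j
      from-injective zero             zero             _   = refl
      from-injective zero             (suc zero)       p≡m = ⊥-elim (Adj⇒≢ m~p (≡.sym p≡m))
      from-injective zero             (suc (suc zero)) p≡q = ⊥-elim (p≢q p≡q)
      from-injective (suc zero)       zero             m≡p = ⊥-elim (Adj⇒≢ m~p m≡p)
      from-injective (suc zero)       (suc zero)       _   = refl
      from-injective (suc zero)       (suc (suc zero)) m≡q = ⊥-elim (Adj⇒≢ m~q m≡q)
      from-injective (suc (suc zero)) zero             q≡p = ⊥-elim (p≢q (≡.sym q≡p))
      from-injective (suc (suc zero)) (suc zero)       q≡m = ⊥-elim (Adj⇒≢ m~q (≡.sym q≡m))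
      from-injective (suc (suc zero)) (suc (suc zero)) _   = refl

      to-from : ∀ i → to (from i) ≡ i
      to-from i = from-injective _ _ (from-to (from i))

      adj-from : ∀ i j → adj G (from i) (from j) ≡ P3adj i j
      adj-from zero             zero             = irrefl G p
      adj-from zero             (suc zero)       = Adj-sym m~p
      adj-from zero             (suc (suc zero)) = ¬Adj⇒adj≡false p≁q
      adj-from (suc zero)       zero             = m~p
      adj-from (suc zero)       (suc zero)       = irrefl G m
      adj-from (suc zero)       (suc (suc zero)) = m~q
      adj-from (suc (suc zero)) zero             = ¬Adj⇒adj≡false (p≁q ∘ Adj-sym)
      adj-from (suc (suc zero)) (suc zero)       = Adj-sym m~q
      adj-from (suc (suc zero)) (suc (suc zero)) = irrefl G q

      adj-to : ∀ u v → adj G u v ≡ P3adj (to u) (to v)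
      adj-to u v = ≡.trans (cong₂ (adj G) (≡.sym (from-to u)) (≡.sym (from-to v)))
                           (adj-from (to u) (to v))

    cherry⇒Isomorphic-P3 : Isomorphic G P3
    cherry⇒Isomorphic-P3 = mk↔ₛ′ to from to-from from-to , adj-to

module _ {n k : ℕ} (G : Graph n) (c : Colouring n k) where

  Incident : Fin n → Fin k → Set
  Incident u i = ∃[ w ] (Adj G u w × c u w ≡ i)

  IncidenceSeparating : Set
  IncidenceSeparating = ∀ u v → (∀ i → Incident u i → Incident v i) →
                                (∀ i → Incident v i → Incident u i) → u ≡ v

  Incident⇒DistToClass0 : ∀ {u i} → Incident u i → DistToClass G c u i 0
  Incident⇒DistToClass0 {u} (w , u~w , cuw≡i) =
    (u , w , u~w , cuw≡i , 0 , 1 , Dist-refl G u , Adj⇒Dist1 G u~w , refl) , λ _ _ _ _ _ _ → z≤n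

  Incident-DistToClass⇒≡0 : ∀ {u i m} → Incident u i → DistToClass G c u i m → m ≡ 0
  Incident-DistToClass⇒≡0 {u} (w , u~w , cuw≡i) (_ , minimal) =
    n≤0⇒n≡0 (minimal u w u~w cuw≡i 0 (0 , 1 , Dist-refl G u , Adj⇒Dist1 G u~w , refl))

  -- An edge at distance 0 has an end at distance 0, which is the vertex itself;
  -- if it is the second end, symmetry of the colouring reorients the edge.
  DistToClass0⇒Incident : (∀ u v → Adj G u v → c u v ≡ c v u) →
    ∀ {v i} → DistToClass G c v i 0 → Incident v i
  DistToClass0⇒Incident _ ((_ , y , x~y , cxy≡i , zero , _ , (here , _) , _) , _) =
    y , x~y , cxy≡i
  DistToClass0⇒Incident c-sym ((x , _ , x~y , cxy≡i , suc _ , zero , _ , (here , _) , _) , _) =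
    x , Adj-sym G x~y , ≡.trans (c-sym _ _ (Adj-sym G x~y)) cxy≡i
  DistToClass0⇒Incident _ ((_ , _ , _ , _ , suc _ , suc _ , _ , _ , ()) , _)

  fullyIncident⇒SameCode : ∀ {u v} → (∀ i → Incident u i) → (∀ i → Incident v i) →
    SameCode G c u v
  fullyIncident⇒SameCode incᵘ incᵛ i m = transfer incᵘ incᵛ , transfer incᵛ incᵘ
    where
    transfer : ∀ {a b} → (∀ i → Incident a i) → (∀ i → Incident b i) →
      DistToClass G c a i m → DistToClass G c b i m
    transfer incᵃ incᵇ d with Incident-DistToClass⇒≡0 (incᵃ i) d
    ... | refl = Incident⇒DistToClass0 (incᵇ i)

  SameCode⇒Incident : (∀ u v → Adj G u v → c u v ≡ c v u) →
    ∀ {u v} → SameCode G c u v → ∀ i → Incident u i → Incident v i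
  SameCode⇒Incident c-sym same i =
    DistToClass0⇒Incident c-sym ∘ proj₁ (same i 0) ∘ Incident⇒DistToClass0

  IncidenceSeparating⇒locating : (∀ u v → Adj G u v → c u v ≡ c v u) →
    IncidenceSeparating → ∀ u v → SameCode G c u v → u ≡ v
  IncidenceSeparating⇒locating c-sym separating u v same =
    separating u v (SameCode⇒Incident c-sym same)
                   (SameCode⇒Incident c-sym (λ i m → swap (same i m)))

¬HasEdgeLocatingColouring-<2 : ∀ {n} (G : Graph (suc (suc n))) → Connected G →
  ∀ j → j < 2 → ¬ HasEdgeLocatingColouring G j
¬HasEdgeLocatingColouring-<2 G conn zero _ (c , _) with c zero zero
... | ()
¬HasEdgeLocatingColouring-<2 G conn (suc zero) _ (c , _ , locating) =
  0≢1 (locating zero (suc zero)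
         (fullyIncident⇒SameCode G c (fullyIncident 0≢1) (fullyIncident (0≢1 ∘ ≡.sym))))
  where
  0≢1 : zero ≢ suc zero
  0≢1 ()
  fullyIncident : ∀ {u v} → u ≢ v → ∀ i → Incident G c u i
  fullyIncident u≢v i with connected⇒neighbour G conn u≢v
  ... | w , u~w = w , u~w , Fin1-irrelevant _ i
¬HasEdgeLocatingColouring-<2 G conn (suc (suc _)) (s≤s (s≤s ()))

module _ {n : ℕ} {G : Graph n} {c : Colouring n 2} (proper : IsProperEdgeColouring G c) where

  private
    distinct-colours : ∀ {u v w} → Adj G u v → Adj G u w → v ≢ w → c u v ≢ c u w
    distinct-colours = proj₁ (proj₂ proper) _ _ _

  HasTwoNeighbours⇒fullyIncident : ∀ {u} → HasTwoNeighbours G u → ∀ i → Incident G c u i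
  HasTwoNeighbours⇒fullyIncident (p , q , u~p , u~q , p≢q) i
    with Fin2-either _ _ i (distinct-colours u~p u~q p≢q)
  ... | inj₁ i≡cup = p , u~p , ≡.sym i≡cup
  ... | inj₂ i≡cuq = q , u~q , ≡.sym i≡cuq

  neighbour-of-two-coloured : ∀ {u p q r} → Adj G u p → Adj G u q → p ≢ q →
    Adj G u r → r ≡ p ⊎ r ≡ q
  neighbour-of-two-coloured {p = p} {q} {r} u~p u~q p≢q u~r
    with r ≟ᶠ p | r ≟ᶠ q
  ... | yes r≡p | _           = inj₁ r≡p
  ... | no _    | yes r≡q = inj₂ r≡q
  ... | no r≢p  | no r≢q  with Fin2-either _ _ (c _ r) (distinct-colours u~p u~q p≢q)
  ...   | inj₁ cur≡cup = ⊥-elim (distinct-colours u~p u~r (r≢p ∘ ≡.sym) (≡.sym cur≡cup))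
  ...   | inj₂ cur≡cuq = ⊥-elim (distinct-colours u~q u~r (r≢q ∘ ≡.sym) (≡.sym cur≡cuq))

  module _ (locating : ∀ u v → SameCode G c u v → u ≡ v) where

    HasTwoNeighbours-unique : ∀ {u v} → HasTwoNeighbours G u → HasTwoNeighbours G v → u ≡ v
    HasTwoNeighbours-unique twoᵘ twoᵛ =
      locating _ _ (fullyIncident⇒SameCode G c (HasTwoNeighbours⇒fullyIncident twoᵘ)
                                               (HasTwoNeighbours⇒fullyIncident twoᵛ))

    neighbour-of-branch-is-leaf : ∀ {m p r} → HasTwoNeighbours G m → Adj G m p →
      Adj G p r → r ≡ m
    neighbour-of-branch-is-leaf {m} {p} {r} twoᵐ m~p p~r =
      decidable-stable (r ≟ᶠ m) λ r≢m →
        Adj⇒≢ G m~p (≡.sym (HasTwoNeighbours-unique (m , r , Adj-sym G m~p , p~r , r≢m ∘ ≡.sym) twoᵐ))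

    locating-two-colouring⇒Isomorphic-P3 : Connected G → (x y z : Fin n) →
      x ≢ y → x ≢ z → y ≢ z → Isomorphic G P3
    locating-two-colouring⇒Isomorphic-P3 conn x y z x≢y x≢z y≢z
      with connected⇒∃HasTwoNeighbours G conn x y z x≢y x≢z y≢z
    ... | m , two@(p , q , m~p , m~q , p≢q) =
      cherry⇒Isomorphic-P3 G m~p m~q p≁q p≢q
        (connected-closed⇒total G conn closed (inj₂ (inj₁ refl)))
      where
      p≁q : ¬ Adj G p q
      p≁q p~q = Adj⇒≢ G m~q (≡.sym (neighbour-of-branch-is-leaf two m~p p~q))
      closed : Closed G (λ v → v ≡ p ⊎ v ≡ m ⊎ v ≡ q)
      closed (inj₁ refl)        p~v = inj₂ (inj₁ (neighbour-of-branch-is-leaf two m~p p~v))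
      closed (inj₂ (inj₁ refl)) m~v = map₂ inj₂ (neighbour-of-two-coloured m~p m~q p≢q m~v)
      closed (inj₂ (inj₂ refl)) q~v = inj₂ (inj₁ (neighbour-of-branch-is-leaf two m~q q~v))

module _ {n m k : ℕ} (G : Graph n) (H : Graph m) (f : Fin n ↔ Fin m)
         (f-adj : ∀ u v → adj G u v ≡ adj H (Inverse.to f u) (Inverse.to f v))
         (c : Colouring m k) where

  open Inverse f using (to; from; strictlyInverseˡ)

  pullback : Colouring n k
  pullback u v = c (to u) (to v)

  private
    to-Adj : ∀ {u v} → Adj G u v → Adj H (to u) (to v)
    to-Adj {u} {v} u~v = ≡.trans (≡.sym (f-adj u v)) u~v

    to-injective : ∀ {u v} → to u ≡ to v → u ≡ v
    to-injective = Injection.injective (↔⇒↣ f)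

    Incident-to : ∀ {u i} → Incident G pullback u i → Incident H c (to u) i
    Incident-to (w , u~w , e) = to w , to-Adj u~w , e

    Incident-from : ∀ {u i} → Incident H c (to u) i → Incident G pullback u i
    Incident-from {u} (y , tu~y , e) =
        from y
      , ≡.trans (f-adj u (from y)) (≡.trans (cong (adj H (to u)) (strictlyInverseˡ y)) tu~y)
      , ≡.trans (cong (c (to u)) (strictlyInverseˡ y)) e

  pullback-proper : IsProperEdgeColouring H c → IsProperEdgeColouring G pullback
  pullback-proper (c-sym , c-distinct , c-nonempty) =
      (λ _ _ u~v → c-sym _ _ (to-Adj u~v))
    , (λ _ _ _ u~v u~w v≢w → c-distinct _ _ _ (to-Adj u~v) (to-Adj u~w) (v≢w ∘ to-injective))
    , nonempty
    where
    nonempty : ∀ i → ∃[ x ] ∃[ y ] (Adj G x y × pullback x y ≡ i)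
    nonempty i with c-nonempty i
    ... | x , y , x~y , e
      with Incident-from (subst (λ z → Incident H c z i) (≡.sym (strictlyInverseˡ x)) (y , x~y , e))
    ...   | w , u~w , e′ = from x , w , u~w , e′

  pullback-separating : IncidenceSeparating H c → IncidenceSeparating G pullback
  pullback-separating separating u v u⊆v v⊆u =
    to-injective (separating (to u) (to v) (λ i → Incident-to ∘ u⊆v i ∘ Incident-from)
                                           (λ i → Incident-to ∘ v⊆u i ∘ Incident-from))

-- Edge 0 — 1 gets colour 0 and edge 1 — 2 colour 1.
P3-colouring : Colouring 3 2
P3-colouring zero    _       = zero
P3-colouring (suc _) zero    = zero
P3-colouring (suc _) (suc _) = suc zero

P3-colouring-comm : ∀ u v → P3-colouring u v ≡ P3-colouring v u
P3-colouring-comm zero    zero    = refl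
P3-colouring-comm zero    (suc _) = refl
P3-colouring-comm (suc _) zero    = refl
P3-colouring-comm (suc _) (suc _) = refl

P3-colouring-proper : IsProperEdgeColouring P3 P3-colouring
P3-colouring-proper = (λ u v _ → P3-colouring-comm u v) , distinct , nonempty
  where
  distinct : ∀ u v w → Adj P3 u v → Adj P3 u w → v ≢ w →
    P3-colouring u v ≢ P3-colouring u w
  distinct zero             (suc zero)       (suc zero)       _ _ v≢w _ = v≢w refl
  distinct (suc zero)       zero             zero             _ _ v≢w _ = v≢w refl
  distinct (suc zero)       zero             (suc (suc zero)) _ _ _   ()
  distinct (suc zero)       (suc (suc zero)) zero             _ _ _   ()
  distinct (suc zero)       (suc (suc zero)) (suc (suc zero)) _ _ v≢w _ = v≢w refl
  distinct (suc (suc zero)) (suc zero)       (suc zero)       _ _ v≢w _ = v≢w refl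
  nonempty : ∀ i → ∃[ x ] ∃[ y ] (Adj P3 x y × P3-colouring x y ≡ i)
  nonempty zero       = zero , suc zero , refl , refl
  nonempty (suc zero) = suc zero , suc (suc zero) , refl , refl

P3-colouring-separating : IncidenceSeparating P3 P3-colouring
P3-colouring-separating = separating
  where
  ¬Incident-0-1 : ¬ Incident P3 P3-colouring zero (suc zero)
  ¬Incident-0-1 (zero             , ()   , _)
  ¬Incident-0-1 (suc zero         , _    , ())
  ¬Incident-0-1 (suc (suc zero)   , ()   , _)
  ¬Incident-2-0 : ¬ Incident P3 P3-colouring (suc (suc zero)) zero
  ¬Incident-2-0 (zero             , ()   , _)
  ¬Incident-2-0 (suc zero         , _    , ())
  ¬Incident-2-0 (suc (suc zero)   , ()   , _)
  separating : IncidenceSeparating P3 P3-colouring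
  separating zero             zero             _ _ = refl
  separating zero             (suc zero)       _ ⊇ = ⊥-elim (¬Incident-0-1 (⊇ _ (suc (suc zero) , refl , refl)))
  separating zero             (suc (suc zero)) ⊆ _ = ⊥-elim (¬Incident-2-0 (⊆ _ (suc zero , refl , refl)))
  separating (suc zero)       zero             ⊆ _ = ⊥-elim (¬Incident-0-1 (⊆ _ (suc (suc zero) , refl , refl)))
  separating (suc zero)       (suc zero)       _ _ = refl
  separating (suc zero)       (suc (suc zero)) ⊆ _ = ⊥-elim (¬Incident-2-0 (⊆ _ (zero , refl , refl)))
  separating (suc (suc zero)) zero             _ ⊇ = ⊥-elim (¬Incident-2-0 (⊇ _ (suc zero , refl , refl)))
  separating (suc (suc zero)) (suc zero)       _ ⊇ = ⊥-elim (¬Incident-2-0 (⊇ _ (zero , refl , refl)))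
  separating (suc (suc zero)) (suc (suc zero)) _ _ = refl

proposition3 : ∀ {n} (G : Graph n) → 3 ≤ n → Connected G →
    (EdgeLocatingChromaticIndex G 2 → Isomorphic G P3)
    × (Isomorphic G P3 → EdgeLocatingChromaticIndex G 2)
proposition3 G (s≤s (s≤s (s≤s _))) conn = forward , backward
  where
  forward : EdgeLocatingChromaticIndex G 2 → Isomorphic G P3
  forward ((_ , proper , locating) , _) =
    locating-two-colouring⇒Isomorphic-P3 proper locating conn
      zero (suc zero) (suc (suc zero)) (λ ()) (λ ()) (λ ())
  backward : Isomorphic G P3 → EdgeLocatingChromaticIndex G 2
  backward (f , f-adj) =
    (c , proper , IncidenceSeparating⇒locating G c (proj₁ proper)
                    (pullback-separating G P3 f f-adj P3-colouring P3-colouring-separating))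
    , ¬HasEdgeLocatingColouring-<2 G conn
    where
    c : Colouring _ 2
    c = pullback G P3 f f-adj P3-colouring
    proper : IsProperEdgeColouring G c
    proper = pullback-proper G P3 f f-adj P3-colouring P3-colouring-proper
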